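{- For $n\ge0$ let $$\tilde J_2(n)=\sum_{j=0}^n(-1)^j\binom{ -\frac12}{j}^{2}\binom nj,\qquad A_2(n)=\sum_{k=0}^n\binom nk^{2}\binom{n+k}{k}.$$ Then for every odd prime $p$, $$\tilde J_2\!\left(\tfrac{p-1}{2}\right)\equiv A_2\!\left(\tfrac{p-1}{2}\right)\pmod{p^2}.$$
   Context: $\binom{ -1/2}{j}=\frac{(-1/2)(-1/2-1)\cdots(-1/2-j+1)}{j!}$; $\tilde J_2(n)$ is a rational number with power-of-$2$ denominator, and the congruence is understood in $\mathbb{Z}_{(p)}$. $A_2(n)$ are the Apéry numbers for $\zeta(2)$. -}

module Defs where

open import Data.Nat as ℕ using (ℕ; zero; suc)
open import Data.Nat.Divisibility using (_∣_)
open import Data.Nat.Combinatorics using (_C_)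
open import Data.Integer as ℤ using (ℤ; +_; -[1+_])
open import Data.Rational as ℚ using (ℚ; _/_; _+_; _*_; _-_; -_; 0ℚ; 1ℚ)
open import Data.Product using (∃; _×_)
open import Relation.Nullary using (¬_)
open import Relation.Binary.PropositionalEquality using (_≡_)

ℕ→ℚ : ℕ → ℚ
ℕ→ℚ n = + n / 1

sumℚ : (ℕ → ℚ) → ℕ → ℚ
sumℚ f zero    = f 0
sumℚ f (suc n) = sumℚ f n + f (suc n)

sumℕ : (ℕ → ℕ) → ℕ → ℕ
sumℕ f zero    = f 0
sumℕ f (suc n) = sumℕ f n ℕ.+ f (suc n)

gbinom : ℚ → ℕ → ℚ
gbinom x zero    = 1ℚ
gbinom x (suc j) = gbinom x j * (x - ℕ→ℚ j) * (+ 1 / suc j)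

minusHalf : ℚ
minusHalf = -[1+ 0 ] / 2

signℚ : ℕ → ℚ
signℚ zero    = 1ℚ
signℚ (suc j) = - signℚ j

J₂ : ℕ → ℚ
J₂ n = sumℚ (λ j → signℚ j * (gbinom minusHalf j * gbinom minusHalf j) * ℕ→ℚ (n C j)) n

A₂ : ℕ → ℕ
A₂ n = sumℕ (λ k → (n C k) ℕ.* (n C k) ℕ.* ((n ℕ.+ k) C k)) n

-- congruence a ≡ b (mod p^e) in ℤ_(p):  a - b = p^e * r with r ∈ ℚ, p ∤ denominator(r)
CongZp : ℕ → ℕ → ℚ → ℚ → Set
CongZp p e a b = ∃ λ (r : ℚ) → (¬ (p ∣ ℚ.denominatorℕ r)) × (a - b ≡ ℕ→ℚ (p ℕ.^ e) * r)

-- Write p = 2n + 1.  Both summands factor as products of ratios over (j+1)²: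
-- (−1)ᵏ C(−1/2, k)² = ∏_{j<k} −(j + 1/2)² / (j+1)²  and
-- C(n, k) C(n+k, k) = ∏_{j<k} (n − j)(n + j + 1) / (j+1)².
-- For j < n all these ratios lie in ℤ₍p₎, and corresponding ratios differ by
-- −((j + 1/2)² + (n − j)(n + j + 1)) / (j+1)² = −(p/2)² / (j+1)², a multiple of p².
-- A product of congruent p-integral factors is congruent, so the k-th summands of
-- J̃₂(n) and A₂(n), and hence the two sums, agree modulo p² in ℤ₍p₎.
module Submission where

open import Defs
open import Data.Nat using (ℕ; _∸_; _/_)
open import Data.Nat.Primality using (Prime)
open import Relation.Binary.PropositionalEquality using (_≢_)

open import Data.Nat as ℕ using (zero; suc; _≤_; _<_; _!)
import Data.Nat.Properties as ℕₚ
open import Data.Nat.Combinatorics using (_C_; nCk≡n!/k![n-k]!; k![n∸k]!∣n!)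
open import Data.Nat.DivMod using (_%_; m/n*n≡m; m≡m%n+[m/n]*n; m%n<n; m*n/n≡m)
open import Data.Nat.Solver using () renaming (module +-*-Solver to ℕ-Solver)
open import Data.Nat.Divisibility using (_∣_; divides; ∣-trans; ∣1⇒≡1; >⇒∤; m%n≡0⇒n∣m)
open import Data.Nat.Primality using (euclidsLemma; ¬prime[1]; prime⇒irreducible)
import Data.Nat.Coprimality as Coprimality
open import Data.Integer as ℤ using (ℤ; +_; -[1+_])
import Data.Integer.Properties as ℤₚ
open import Data.Rational as ℚ using (ℚ; mkℚ; _+_; _*_; _-_; -_; 1ℚ; toℚᵘ)
import Data.Rational.Properties as ℚₚ
import Data.Rational.Unnormalised as ℚᵘ
import Data.Rational.Unnormalised.Properties as ℚᵘₚ
open import Data.Rational.Solver using (module +-*-Solver)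
open import Data.Product using (_×_; _,_; proj₁; proj₂)
open import Data.Empty using (⊥-elim)
open import Data.Sum using (inj₁; inj₂)
open import Relation.Nullary using (¬_)
open import Relation.Binary.PropositionalEquality
  using (_≡_; refl; sym; trans; cong; cong₂; subst; subst₂; module ≡-Reasoning)

ℤ→ℚ : ℤ → ℚ
ℤ→ℚ a = a ℚ./ 1

toℚᵘ-ℤ→ℚ : ∀ a → toℚᵘ (ℤ→ℚ a) ℚᵘ.≃ ℚᵘ.mkℚᵘ a 0
toℚᵘ-ℤ→ℚ a = ℚₚ.toℚᵘ-fromℚᵘ (ℚᵘ.mkℚᵘ a 0)

-- a / 1 does not reduce for a variable a, so identities about ℤ→ℚ are proved via toℚᵘ.
ℤ→ℚ-homo-+ : ∀ a b → ℤ→ℚ (a ℤ.+ b) ≡ ℤ→ℚ a + ℤ→ℚ b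
ℤ→ℚ-homo-+ a b = ℚₚ.toℚᵘ-injective (begin
  toℚᵘ (ℤ→ℚ (a ℤ.+ b))                  ≈⟨ toℚᵘ-ℤ→ℚ (a ℤ.+ b) ⟩
  ℚᵘ.mkℚᵘ (a ℤ.+ b) 0                   ≈⟨ ℚᵘ.*≡* cross ⟩
  ℚᵘ.mkℚᵘ a 0 ℚᵘ.+ ℚᵘ.mkℚᵘ b 0          ≈⟨ ℚᵘₚ.+-cong (toℚᵘ-ℤ→ℚ a) (toℚᵘ-ℤ→ℚ b) ⟨
  toℚᵘ (ℤ→ℚ a) ℚᵘ.+ toℚᵘ (ℤ→ℚ b)        ≈⟨ ℚₚ.toℚᵘ-homo-+ (ℤ→ℚ a) (ℤ→ℚ b) ⟨
  toℚᵘ (ℤ→ℚ a + ℤ→ℚ b)                  ∎)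
  where
  open ℚᵘₚ.≃-Reasoning
  cross : (a ℤ.+ b) ℤ.* + 1 ≡ (a ℤ.* + 1 ℤ.+ b ℤ.* + 1) ℤ.* + 1
  cross rewrite ℤₚ.*-identityʳ a | ℤₚ.*-identityʳ b = refl

ℤ→ℚ-homo-* : ∀ a b → ℤ→ℚ (a ℤ.* b) ≡ ℤ→ℚ a * ℤ→ℚ b
ℤ→ℚ-homo-* a b = ℚₚ.toℚᵘ-injective (begin
  toℚᵘ (ℤ→ℚ (a ℤ.* b))                  ≈⟨ toℚᵘ-ℤ→ℚ (a ℤ.* b) ⟩
  ℚᵘ.mkℚᵘ (a ℤ.* b) 0                   ≈⟨ ℚᵘₚ.≃-refl ⟩
  ℚᵘ.mkℚᵘ a 0 ℚᵘ.* ℚᵘ.mkℚᵘ b 0          ≈⟨ ℚᵘₚ.*-cong (toℚᵘ-ℤ→ℚ a) (toℚᵘ-ℤ→ℚ b) ⟨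
  toℚᵘ (ℤ→ℚ a) ℚᵘ.* toℚᵘ (ℤ→ℚ b)        ≈⟨ ℚₚ.toℚᵘ-homo-* (ℤ→ℚ a) (ℤ→ℚ b) ⟨
  toℚᵘ (ℤ→ℚ a * ℤ→ℚ b)                  ∎)
  where open ℚᵘₚ.≃-Reasoning

ℕ→ℚ-homo-+ : ∀ m n → ℕ→ℚ (m ℕ.+ n) ≡ ℕ→ℚ m + ℕ→ℚ n
ℕ→ℚ-homo-+ m n = trans (cong ℤ→ℚ (ℤₚ.pos-+ m n)) (ℤ→ℚ-homo-+ (+ m) (+ n))

ℕ→ℚ-homo-* : ∀ m n → ℕ→ℚ (m ℕ.* n) ≡ ℕ→ℚ m * ℕ→ℚ n
ℕ→ℚ-homo-* m n = trans (cong ℤ→ℚ (ℤₚ.pos-* m n)) (ℤ→ℚ-homo-* (+ m) (+ n))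

ℕ→ℚ-homo-∸ : ∀ {m n} → m ≤ n → ℕ→ℚ (n ∸ m) ≡ ℕ→ℚ n - ℕ→ℚ m
ℕ→ℚ-homo-∸ {m} {n} m≤n = begin
  ℕ→ℚ (n ∸ m)                          ≡⟨ solve 2 (λ x y → x := x :+ y :- y) refl (ℕ→ℚ (n ∸ m)) (ℕ→ℚ m) ⟩
  ℕ→ℚ (n ∸ m) + ℕ→ℚ m - ℕ→ℚ m          ≡⟨ cong (_- ℕ→ℚ m) (ℕ→ℚ-homo-+ (n ∸ m) m) ⟨
  ℕ→ℚ (n ∸ m ℕ.+ m) - ℕ→ℚ m            ≡⟨ cong (λ x → ℕ→ℚ x - ℕ→ℚ m) (ℕₚ.m∸n+n≡m m≤n) ⟩
  ℕ→ℚ n - ℕ→ℚ m                        ∎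
  where
  open ≡-Reasoning
  open +-*-Solver

ℕ→ℚ-homo-sum : ∀ f n → ℕ→ℚ (sumℕ f n) ≡ sumℚ (λ k → ℕ→ℚ (f k)) n
ℕ→ℚ-homo-sum f zero    = refl
ℕ→ℚ-homo-sum f (suc n) =
  trans (ℕ→ℚ-homo-+ (sumℕ f n) (f (suc n))) (cong (_+ ℕ→ℚ (f (suc n))) (ℕ→ℚ-homo-sum f n))

1/suc : ℕ → ℚ
1/suc d = + 1 ℚ./ suc d

1/suc-*-inverse : ∀ d → 1/suc d * ℕ→ℚ (suc d) ≡ 1ℚ
1/suc-*-inverse d = ℚₚ.toℚᵘ-injective (begin
  toℚᵘ (1/suc d * ℕ→ℚ (suc d))                   ≈⟨ ℚₚ.toℚᵘ-homo-* (1/suc d) (ℕ→ℚ (suc d)) ⟩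
  toℚᵘ (1/suc d) ℚᵘ.* toℚᵘ (ℕ→ℚ (suc d))         ≈⟨ ℚᵘₚ.*-cong (ℚₚ.toℚᵘ-fromℚᵘ (ℚᵘ.mkℚᵘ (+ 1) d)) (toℚᵘ-ℤ→ℚ (+ suc d)) ⟩
  ℚᵘ.mkℚᵘ (+ 1) d ℚᵘ.* ℚᵘ.mkℚᵘ (+ suc d) 0        ≈⟨ ℚᵘₚ.*-inverseˡ (ℚᵘ.mkℚᵘ (+ suc d) 0) ⟩
  ℚᵘ.1ℚᵘ                                          ∎)
  where open ℚᵘₚ.≃-Reasoning

prodℚ : (ℕ → ℚ) → ℕ → ℚ
prodℚ f zero    = 1ℚ
prodℚ f (suc k) = prodℚ f k * f k

nCk*[k!*[n∸k]!]≡n! : ∀ {n k} → k ≤ n → (n C k) ℕ.* (k ! ℕ.* (n ∸ k) !) ≡ n !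
nCk*[k!*[n∸k]!]≡n! {n} {k} k≤n = begin
  (n C k) ℕ.* (k ! ℕ.* (n ∸ k) !)                             ≡⟨ cong (ℕ._* (k ! ℕ.* (n ∸ k) !)) (nCk≡n!/k![n-k]! k≤n) ⟩
  (n ! / (k ! ℕ.* (n ∸ k) !)) {{k!*[n∸k]!≢0}} ℕ.* (k ! ℕ.* (n ∸ k) !) ≡⟨ m/n*n≡m {{k!*[n∸k]!≢0}} (k![n∸k]!∣n! k≤n) ⟩
  n !                                                         ∎
  where
  open ≡-Reasoning
  k!*[n∸k]!≢0 : ℕ.NonZero (k ! ℕ.* (n ∸ k) !)
  k!*[n∸k]!≢0 = ℕₚ._!*_!≢0 k (n ∸ k)

[k+m]Ck*[k!*m!]≡[k+m]! : ∀ k m → ((k ℕ.+ m) C k) ℕ.* (k ! ℕ.* m !) ≡ (k ℕ.+ m) !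
[k+m]Ck*[k!*m!]≡[k+m]! k m = subst (λ l → ((k ℕ.+ m) C k) ℕ.* (k ! ℕ.* l !) ≡ (k ℕ.+ m) !)
                                  (ℕₚ.m+n∸m≡n k m) (nCk*[k!*[n∸k]!]≡n! (ℕₚ.m≤m+n k m))

[n+1]C[k+1]*[k+1]≡[n+1]*nCk : ∀ {n k} → k ≤ n → (suc n C suc k) ℕ.* suc k ≡ suc n ℕ.* (n C k)
[n+1]C[k+1]*[k+1]≡[n+1]*nCk {k = k} k≤n with ℕₚ.m≤n⇒∃[o]m+o≡n k≤n
... | m , refl = ℕₚ.*-cancelʳ-≡ _ _ (k ! ℕ.* m !) {{ℕₚ._!*_!≢0 k m}} (begin
  ((suc k ℕ.+ m) C suc k) ℕ.* suc k ℕ.* (k ! ℕ.* m !)   ≡⟨ solve 4 (λ c s f g → c :* s :* (f :* g) := c :* (s :* f :* g)) refl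
                                                               ((suc k ℕ.+ m) C suc k) (suc k) (k !) (m !) ⟩
  ((suc k ℕ.+ m) C suc k) ℕ.* (suc k ! ℕ.* m !)          ≡⟨ [k+m]Ck*[k!*m!]≡[k+m]! (suc k) m ⟩
  suc (k ℕ.+ m) ℕ.* (k ℕ.+ m) !                          ≡⟨ cong (suc (k ℕ.+ m) ℕ.*_) ([k+m]Ck*[k!*m!]≡[k+m]! k m) ⟨
  suc (k ℕ.+ m) ℕ.* (((k ℕ.+ m) C k) ℕ.* (k ! ℕ.* m !))  ≡⟨ ℕₚ.*-assoc (suc (k ℕ.+ m)) ((k ℕ.+ m) C k) (k ! ℕ.* m !) ⟨
  suc (k ℕ.+ m) ℕ.* ((k ℕ.+ m) C k) ℕ.* (k ! ℕ.* m !)    ∎)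
  where
  open ≡-Reasoning
  open ℕ-Solver

nC[k+1]*[k+1]≡nCk*[n∸k] : ∀ {n k} → k < n → (n C suc k) ℕ.* suc k ≡ (n C k) ℕ.* (n ∸ k)
nC[k+1]*[k+1]≡nCk*[n∸k] {k = k} k<n with ℕₚ.m≤n⇒∃[o]m+o≡n k<n
... | m , refl = ℕₚ.*-cancelʳ-≡ _ _ (k ! ℕ.* m !) {{ℕₚ._!*_!≢0 k m}} (begin
  ((suc k ℕ.+ m) C suc k) ℕ.* suc k ℕ.* (k ! ℕ.* m !)        ≡⟨ solve 4 (λ c s f g → c :* s :* (f :* g) := c :* (s :* f :* g)) refl
                                                                    ((suc k ℕ.+ m) C suc k) (suc k) (k !) (m !) ⟩
  ((suc k ℕ.+ m) C suc k) ℕ.* (suc k ! ℕ.* m !)               ≡⟨ [k+m]Ck*[k!*m!]≡[k+m]! (suc k) m ⟩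
  (suc k ℕ.+ m) !                                             ≡⟨ cong _! (ℕₚ.+-suc k m) ⟨
  (k ℕ.+ suc m) !                                             ≡⟨ [k+m]Ck*[k!*m!]≡[k+m]! k (suc m) ⟨
  ((k ℕ.+ suc m) C k) ℕ.* (k ! ℕ.* suc m !)                   ≡⟨ cong (λ l → (l C k) ℕ.* (k ! ℕ.* suc m !)) (ℕₚ.+-suc k m) ⟩
  ((suc k ℕ.+ m) C k) ℕ.* (k ! ℕ.* suc m !)                   ≡⟨ solve 4 (λ c s f g → c :* (f :* (s :* g)) := c :* s :* (f :* g)) refl
                                                                    ((suc k ℕ.+ m) C k) (suc m) (k !) (m !) ⟩
  ((suc k ℕ.+ m) C k) ℕ.* suc m ℕ.* (k ! ℕ.* m !)             ≡⟨ cong (λ l → ((suc k ℕ.+ m) C k) ℕ.* l ℕ.* (k ! ℕ.* m !)) [k+1+m]∸k≡m+1 ⟨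
  ((suc k ℕ.+ m) C k) ℕ.* (suc k ℕ.+ m ∸ k) ℕ.* (k ! ℕ.* m !) ∎)
  where
  open ≡-Reasoning
  open ℕ-Solver
  [k+1+m]∸k≡m+1 : suc k ℕ.+ m ∸ k ≡ suc m
  [k+1+m]∸k≡m+1 = trans (cong (_∸ k) (sym (ℕₚ.+-suc k m))) (ℕₚ.m+n∸m≡n k (suc m))

record PIntegral (p : ℕ) (x : ℚ) : Set where
  constructor clearedBy
  field
    numerator     : ℤ
    denominator   : ℕ
    p∤denominator : ¬ p ∣ denominator
    cleared       : x * ℕ→ℚ denominator ≡ ℤ→ℚ numerator

pIntegral⇒∤denominator : ∀ {p x} → PIntegral p x → ¬ p ∣ ℚ.denominatorℕ x
pIntegral⇒∤denominator {p} {x@(mkℚ num d-1 num⊥den)} (clearedBy a b p∤b xb≡a) p∣den =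
  p∤b (∣-trans p∣den (Coprimality.coprime-divisor den⊥num (divides ℤ.∣ a ∣ num*b≡a*den)))
  where
  d : ℕ
  d = suc d-1
  den⊥num : Coprimality.Coprime d ℤ.∣ num ∣
  den⊥num = Coprimality.sym (Coprimality.recompute num⊥den)
  cross : ℚᵘ.mkℚᵘ num d-1 ℚᵘ.* ℚᵘ.mkℚᵘ (+ b) 0 ℚᵘ.≃ ℚᵘ.mkℚᵘ a 0
  cross = begin
    ℚᵘ.mkℚᵘ num d-1 ℚᵘ.* ℚᵘ.mkℚᵘ (+ b) 0   ≈⟨ ℚᵘₚ.*-congˡ {ℚᵘ.mkℚᵘ num d-1} (toℚᵘ-ℤ→ℚ (+ b)) ⟨
    toℚᵘ x ℚᵘ.* toℚᵘ (ℕ→ℚ b)               ≈⟨ ℚₚ.toℚᵘ-homo-* x (ℕ→ℚ b) ⟨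
    toℚᵘ (x * ℕ→ℚ b)                       ≈⟨ ℚᵘₚ.≃-reflexive (cong toℚᵘ xb≡a) ⟩
    toℚᵘ (ℤ→ℚ a)                           ≈⟨ toℚᵘ-ℤ→ℚ a ⟩
    ℚᵘ.mkℚᵘ a 0                            ∎
    where open ℚᵘₚ.≃-Reasoning
  num*b≡a*den : ℤ.∣ num ∣ ℕ.* b ≡ ℤ.∣ a ∣ ℕ.* d
  num*b≡a*den with cross
  ... | ℚᵘ.*≡* eq = begin
    ℤ.∣ num ∣ ℕ.* b                  ≡⟨ ℤₚ.abs-* num (+ b) ⟨
    ℤ.∣ num ℤ.* + b ∣                ≡⟨ cong ℤ.∣_∣ (ℤₚ.*-identityʳ (num ℤ.* + b)) ⟨
    ℤ.∣ num ℤ.* + b ℤ.* + 1 ∣        ≡⟨ cong ℤ.∣_∣ eq ⟩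
    ℤ.∣ a ℤ.* + suc (d-1 ℕ.* 1) ∣    ≡⟨ cong (λ e → ℤ.∣ a ℤ.* + suc e ∣) (ℕₚ.*-identityʳ d-1) ⟩
    ℤ.∣ a ℤ.* + d ∣                  ≡⟨ ℤₚ.abs-* a (+ d) ⟩
    ℤ.∣ a ∣ ℕ.* d                    ∎
    where open ≡-Reasoning

infix 4 _≡_[mod_at_]
record _≡_[mod_at_] (x y m : ℚ) (p : ℕ) : Set where
  constructor congruentBy
  field
    quotient           : ℚ
    quotient-pIntegral : PIntegral p quotient
    difference         : x - y ≡ m * quotient

≡-mod-p^e⇒CongZp : ∀ {p e x y} → x ≡ y [mod ℕ→ℚ (p ℕ.^ e) at p ] → CongZp p e x y
≡-mod-p^e⇒CongZp (congruentBy r r∈ℤₚ x-y≡p^e*r) = r , pIntegral⇒∤denominator r∈ℤₚ , x-y≡p^e*r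

module _ {p : ℕ} (p-prime : Prime p) where

  ∤-* : ∀ {m n} → ¬ p ∣ m → ¬ p ∣ n → ¬ p ∣ m ℕ.* n
  ∤-* {m} {n} p∤m p∤n p∣mn with euclidsLemma m n p-prime p∣mn
  ... | inj₁ p∣m = p∤m p∣m
  ... | inj₂ p∣n = p∤n p∣n

  ℤ→ℚ-pIntegral : ∀ a → PIntegral p (ℤ→ℚ a)
  ℤ→ℚ-pIntegral a = clearedBy a 1 (λ p∣1 → ¬prime[1] (subst Prime (∣1⇒≡1 p∣1) p-prime)) (ℚₚ.*-identityʳ (ℤ→ℚ a))

  ℕ→ℚ-pIntegral : ∀ n → PIntegral p (ℕ→ℚ n)
  ℕ→ℚ-pIntegral n = ℤ→ℚ-pIntegral (+ n)

  pIntegral-+ : ∀ {x y} → PIntegral p x → PIntegral p y → PIntegral p (x + y)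
  pIntegral-+ {x} {y} (clearedBy a b p∤b xb≡a) (clearedBy c d p∤d yd≡c) =
    clearedBy (a ℤ.* + d ℤ.+ c ℤ.* + b) (b ℕ.* d) (∤-* p∤b p∤d) (begin
      (x + y) * ℕ→ℚ (b ℕ.* d)                       ≡⟨ cong ((x + y) *_) (ℕ→ℚ-homo-* b d) ⟩
      (x + y) * (ℕ→ℚ b * ℕ→ℚ d)                     ≡⟨ solve 4 (λ x y b d → (x :+ y) :* (b :* d) := x :* b :* d :+ y :* d :* b)
                                                               refl x y (ℕ→ℚ b) (ℕ→ℚ d) ⟩
      x * ℕ→ℚ b * ℕ→ℚ d + y * ℕ→ℚ d * ℕ→ℚ b         ≡⟨ cong₂ (λ u v → u * ℕ→ℚ d + v * ℕ→ℚ b) xb≡a yd≡c ⟩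
      ℤ→ℚ a * ℤ→ℚ (+ d) + ℤ→ℚ c * ℤ→ℚ (+ b)         ≡⟨ cong₂ _+_ (ℤ→ℚ-homo-* a (+ d)) (ℤ→ℚ-homo-* c (+ b)) ⟨
      ℤ→ℚ (a ℤ.* + d) + ℤ→ℚ (c ℤ.* + b)             ≡⟨ ℤ→ℚ-homo-+ (a ℤ.* + d) (c ℤ.* + b) ⟨
      ℤ→ℚ (a ℤ.* + d ℤ.+ c ℤ.* + b)                 ∎)
    where
    open ≡-Reasoning
    open +-*-Solver

  pIntegral-* : ∀ {x y} → PIntegral p x → PIntegral p y → PIntegral p (x * y)
  pIntegral-* {x} {y} (clearedBy a b p∤b xb≡a) (clearedBy c d p∤d yd≡c) =
    clearedBy (a ℤ.* c) (b ℕ.* d) (∤-* p∤b p∤d) (begin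
      x * y * ℕ→ℚ (b ℕ.* d)                   ≡⟨ cong (x * y *_) (ℕ→ℚ-homo-* b d) ⟩
      x * y * (ℕ→ℚ b * ℕ→ℚ d)                 ≡⟨ solve 4 (λ x y b d → x :* y :* (b :* d) := x :* b :* (y :* d))
                                                         refl x y (ℕ→ℚ b) (ℕ→ℚ d) ⟩
      x * ℕ→ℚ b * (y * ℕ→ℚ d)                 ≡⟨ cong₂ _*_ xb≡a yd≡c ⟩
      ℤ→ℚ a * ℤ→ℚ c                           ≡⟨ ℤ→ℚ-homo-* a c ⟨
      ℤ→ℚ (a ℤ.* c)                           ∎)
    where
    open ≡-Reasoning
    open +-*-Solver

  pIntegral-neg : ∀ {x} → PIntegral p x → PIntegral p (- x)
  pIntegral-neg {x} x∈ℤₚ = subst (PIntegral p) (solve 1 (λ x → con (ℤ→ℚ -[1+ 0 ]) :* x := :- x) refl x)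
                                 (pIntegral-* (ℤ→ℚ-pIntegral -[1+ 0 ]) x∈ℤₚ)
    where open +-*-Solver

  pIntegral-- : ∀ {x y} → PIntegral p x → PIntegral p y → PIntegral p (x - y)
  pIntegral-- x∈ℤₚ y∈ℤₚ = pIntegral-+ x∈ℤₚ (pIntegral-neg y∈ℤₚ)

  pIntegral-prod : ∀ f k → (∀ j → j < k → PIntegral p (f j)) → PIntegral p (prodℚ f k)
  pIntegral-prod f zero    _  = ℕ→ℚ-pIntegral 1
  pIntegral-prod f (suc k) f∈ℤₚ =
    pIntegral-* (pIntegral-prod f k (λ j j<k → f∈ℤₚ j (ℕₚ.m<n⇒m<1+n j<k))) (f∈ℤₚ k ℕₚ.≤-refl)

  1/suc-pIntegral : ∀ {d} → ¬ p ∣ suc d → PIntegral p (1/suc d)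
  1/suc-pIntegral {d} p∤d+1 = clearedBy (+ 1) (suc d) p∤d+1 (1/suc-*-inverse d)

  minusHalf-pIntegral : ¬ p ∣ 2 → PIntegral p minusHalf
  minusHalf-pIntegral p∤2 = clearedBy -[1+ 0 ] 2 p∤2 refl

  ≡-mod-refl : ∀ {m} x → x ≡ x [mod m at p ]
  ≡-mod-refl {m} x = congruentBy (ℤ→ℚ (+ 0)) (ℤ→ℚ-pIntegral (+ 0)) (solve 2 (λ x m → x :- x := m :* con (ℤ→ℚ (+ 0))) refl x m)
    where open +-*-Solver

  ≡-mod-+ : ∀ {m x y u v} → x ≡ y [mod m at p ] → u ≡ v [mod m at p ] → x + u ≡ y + v [mod m at p ]
  ≡-mod-+ {m} {x} {y} {u} {v} (congruentBy r r∈ℤₚ x-y≡mr) (congruentBy s s∈ℤₚ u-v≡ms) =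
    congruentBy (r + s) (pIntegral-+ r∈ℤₚ s∈ℤₚ) (begin
      x + u - (y + v)        ≡⟨ solve 4 (λ x y u v → x :+ u :- (y :+ v) := (x :- y) :+ (u :- v)) refl x y u v ⟩
      (x - y) + (u - v)      ≡⟨ cong₂ _+_ x-y≡mr u-v≡ms ⟩
      m * r + m * s          ≡⟨ ℚₚ.*-distribˡ-+ m r s ⟨
      m * (r + s)            ∎)
    where
    open ≡-Reasoning
    open +-*-Solver

  ≡-mod-* : ∀ {m x y u v} → PIntegral p y → PIntegral p u →
            x ≡ y [mod m at p ] → u ≡ v [mod m at p ] → x * u ≡ y * v [mod m at p ]
  ≡-mod-* {m} {x} {y} {u} {v} y∈ℤₚ u∈ℤₚ (congruentBy r r∈ℤₚ x-y≡mr) (congruentBy s s∈ℤₚ u-v≡ms) =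
    congruentBy (r * u + y * s) (pIntegral-+ (pIntegral-* r∈ℤₚ u∈ℤₚ) (pIntegral-* y∈ℤₚ s∈ℤₚ)) (begin
      x * u - y * v                ≡⟨ solve 4 (λ x y u v → x :* u :- y :* v := (x :- y) :* u :+ y :* (u :- v)) refl x y u v ⟩
      (x - y) * u + y * (u - v)    ≡⟨ cong₂ (λ a b → a * u + y * b) x-y≡mr u-v≡ms ⟩
      m * r * u + y * (m * s)      ≡⟨ solve 5 (λ m r u y s → m :* r :* u :+ y :* (m :* s) := m :* (r :* u :+ y :* s)) refl m r u y s ⟩
      m * (r * u + y * s)          ∎)
    where
    open ≡-Reasoning
    open +-*-Solver

  ≡-mod-sum : ∀ {m} f g n → (∀ k → k ≤ n → f k ≡ g k [mod m at p ]) → sumℚ f n ≡ sumℚ g n [mod m at p ]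
  ≡-mod-sum f g zero    f≡g = f≡g 0 ℕ.z≤n
  ≡-mod-sum f g (suc n) f≡g =
    ≡-mod-+ (≡-mod-sum f g n (λ k k≤n → f≡g k (ℕₚ.m≤n⇒m≤1+n k≤n))) (f≡g (suc n) ℕₚ.≤-refl)

  ≡-mod-prod : ∀ {m} f g k →
               (∀ j → j < k → PIntegral p (f j) × PIntegral p (g j) × f j ≡ g j [mod m at p ]) →
               prodℚ f k ≡ prodℚ g k [mod m at p ]
  ≡-mod-prod f g zero    _   = ≡-mod-refl 1ℚ
  ≡-mod-prod {m} f g (suc k) f≡g with f≡g k ℕₚ.≤-refl
  ... | fk∈ℤₚ , _ , fk≡gk =
    ≡-mod-* (pIntegral-prod g k (λ j j<k → proj₁ (proj₂ (below j j<k)))) fk∈ℤₚ (≡-mod-prod f g k below) fk≡gk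
    where
    below : ∀ j → j < k → PIntegral p (f j) × PIntegral p (g j) × f j ≡ g j [mod m at p ]
    below j j<k = f≡g j (ℕₚ.m<n⇒m<1+n j<k)

binomSquareRatio : ℚ → ℕ → ℚ
binomSquareRatio x j = - (r * r)
  where
  r : ℚ
  r = (x - ℕ→ℚ j) * 1/suc j

signℚ*gbinom²≡prod : ∀ x k → signℚ k * (gbinom x k * gbinom x k) ≡ prodℚ (binomSquareRatio x) k
signℚ*gbinom²≡prod x zero    = refl
signℚ*gbinom²≡prod x (suc k) = begin
  - signℚ k * (gbinom x k * a * i * (gbinom x k * a * i))   ≡⟨ solve 4 (λ s g a i → (:- s) :* (g :* a :* i :* (g :* a :* i))
                                                                              := s :* (g :* g) :* (:- (a :* i :* (a :* i))))
                                                                  refl (signℚ k) (gbinom x k) a i ⟩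
  signℚ k * (gbinom x k * gbinom x k) * binomSquareRatio x k  ≡⟨ cong (_* binomSquareRatio x k) (signℚ*gbinom²≡prod x k) ⟩
  prodℚ (binomSquareRatio x) k * binomSquareRatio x k         ∎
  where
  open ≡-Reasoning
  open +-*-Solver
  a i : ℚ
  a = x - ℕ→ℚ k
  i = 1/suc k

apéryRatio : ℕ → ℕ → ℚ
apéryRatio n j = ℕ→ℚ (n ∸ j) * ℕ→ℚ (suc (n ℕ.+ j)) * (1/suc j * 1/suc j)

apéryTerm-recurrence : ∀ {n k} → k < n →
            (n C suc k) ℕ.* ((n ℕ.+ suc k) C suc k) ℕ.* (suc k ℕ.* suc k) ≡
            (n C k) ℕ.* ((n ℕ.+ k) C k) ℕ.* (n ∸ k) ℕ.* suc (n ℕ.+ k)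
apéryTerm-recurrence {n} {k} k<n = begin
  (n C suc k) ℕ.* ((n ℕ.+ suc k) C suc k) ℕ.* (suc k ℕ.* suc k)
    ≡⟨ solve 3 (λ a b s → a :* b :* (s :* s) := (a :* s) :* (b :* s)) refl (n C suc k) ((n ℕ.+ suc k) C suc k) (suc k) ⟩
  ((n C suc k) ℕ.* suc k) ℕ.* (((n ℕ.+ suc k) C suc k) ℕ.* suc k)
    ≡⟨ cong₂ ℕ._*_ (nC[k+1]*[k+1]≡nCk*[n∸k] k<n) (cong (λ l → (l C suc k) ℕ.* suc k) (ℕₚ.+-suc n k)) ⟩
  (n C k) ℕ.* (n ∸ k) ℕ.* ((suc (n ℕ.+ k) C suc k) ℕ.* suc k)
    ≡⟨ cong ((n C k) ℕ.* (n ∸ k) ℕ.*_) ([n+1]C[k+1]*[k+1]≡[n+1]*nCk (ℕₚ.m≤n+m k n)) ⟩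
  (n C k) ℕ.* (n ∸ k) ℕ.* (suc (n ℕ.+ k) ℕ.* ((n ℕ.+ k) C k))
    ≡⟨ solve 4 (λ a d s b → a :* d :* (s :* b) := a :* b :* d :* s) refl (n C k) (n ∸ k) (suc (n ℕ.+ k)) ((n ℕ.+ k) C k) ⟩
  (n C k) ℕ.* ((n ℕ.+ k) C k) ℕ.* (n ∸ k) ℕ.* suc (n ℕ.+ k) ∎
  where
  open ≡-Reasoning
  open ℕ-Solver

apéryTerm≡prod : ∀ n k → k ≤ n → ℕ→ℚ ((n C k) ℕ.* ((n ℕ.+ k) C k)) ≡ prodℚ (apéryRatio n) k
apéryTerm≡prod n zero    _   = refl
apéryTerm≡prod n (suc k) k<n = begin
  ℕ→ℚ c′                                         ≡⟨ solve 1 (λ c → c := c :* con 1ℚ :* con 1ℚ) refl (ℕ→ℚ c′) ⟩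
  ℕ→ℚ c′ * 1ℚ * 1ℚ                               ≡⟨ cong (λ u → ℕ→ℚ c′ * u * u) s*i≡1 ⟨
  ℕ→ℚ c′ * (s * i) * (s * i)                     ≡⟨ solve 3 (λ c s i → c :* (s :* i) :* (s :* i) := c :* (s :* s) :* (i :* i)) refl (ℕ→ℚ c′) s i ⟩
  ℕ→ℚ c′ * (s * s) * (i * i)                     ≡⟨ cong (λ u → ℕ→ℚ c′ * u * (i * i)) (ℕ→ℚ-homo-* (suc k) (suc k)) ⟨
  ℕ→ℚ c′ * ℕ→ℚ (suc k ℕ.* suc k) * (i * i)       ≡⟨ cong (_* (i * i)) (ℕ→ℚ-homo-* c′ (suc k ℕ.* suc k)) ⟨
  ℕ→ℚ (c′ ℕ.* (suc k ℕ.* suc k)) * (i * i)       ≡⟨ cong (λ u → ℕ→ℚ u * (i * i)) (apéryTerm-recurrence k<n) ⟩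
  ℕ→ℚ (c ℕ.* (n ∸ k) ℕ.* suc (n ℕ.+ k)) * (i * i) ≡⟨ cong (_* (i * i)) (ℕ→ℚ-homo-* (c ℕ.* (n ∸ k)) (suc (n ℕ.+ k))) ⟩
  ℕ→ℚ (c ℕ.* (n ∸ k)) * d * (i * i)              ≡⟨ cong (λ u → u * d * (i * i)) (ℕ→ℚ-homo-* c (n ∸ k)) ⟩
  ℕ→ℚ c * e * d * (i * i)                        ≡⟨ solve 4 (λ c e d j → c :* e :* d :* j := c :* (e :* d :* j)) refl (ℕ→ℚ c) e d (i * i) ⟩
  ℕ→ℚ c * apéryRatio n k                         ≡⟨ cong (_* apéryRatio n k) (apéryTerm≡prod n k (ℕₚ.<⇒≤ k<n)) ⟩
  prodℚ (apéryRatio n) k * apéryRatio n k        ∎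
  where
  open ≡-Reasoning
  open +-*-Solver
  c c′ : ℕ
  c  = (n C k) ℕ.* ((n ℕ.+ k) C k)
  c′ = (n C suc k) ℕ.* ((n ℕ.+ suc k) C suc k)
  s i d e : ℚ
  s  = ℕ→ℚ (suc k)
  i  = 1/suc k
  d  = ℕ→ℚ (suc (n ℕ.+ k))
  e  = ℕ→ℚ (n ∸ k)
  s*i≡1 : s * i ≡ 1ℚ
  s*i≡1 = trans (ℚₚ.*-comm s i) (1/suc-*-inverse k)

binomSquareRatio-apéryRatio : ∀ {n j} → j ≤ n →
  binomSquareRatio minusHalf j - apéryRatio n j ≡
  ℕ→ℚ (suc (n ℕ.+ n) ℕ.^ 2) * - (minusHalf * 1/suc j * (minusHalf * 1/suc j))
binomSquareRatio-apéryRatio {n} {j} j≤n = begin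
  binomSquareRatio minusHalf j - apéryRatio n j
    ≡⟨ cong₂ (λ u v → binomSquareRatio minusHalf j - u * v * (i * i)) (ℕ→ℚ-homo-∸ j≤n) ℕ→ℚ[1+n+m] ⟩
  - ((minusHalf - J) * i * ((minusHalf - J) * i)) - (N - J) * (1ℚ + (N + J)) * (i * i)
    ≡⟨ solve 3 (λ N J i → :- ((con minusHalf :- J) :* i :* ((con minusHalf :- J) :* i)) :- (N :- J) :* (con 1ℚ :+ (N :+ J)) :* (i :* i)
                          := (con 1ℚ :+ (N :+ N)) :* ((con 1ℚ :+ (N :+ N)) :* con 1ℚ) :* (:- (con minusHalf :* i :* (con minusHalf :* i))))
                refl N J i ⟩
  (1ℚ + (N + N)) * ((1ℚ + (N + N)) * 1ℚ) * - (minusHalf * i * (minusHalf * i))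
    ≡⟨ cong (_* - (minusHalf * i * (minusHalf * i))) ℕ→ℚ[p²] ⟨
  ℕ→ℚ (suc (n ℕ.+ n) ℕ.^ 2) * - (minusHalf * i * (minusHalf * i)) ∎
  where
  open ≡-Reasoning
  open +-*-Solver
  N J i : ℚ
  N = ℕ→ℚ n
  J = ℕ→ℚ j
  i = 1/suc j
  ℕ→ℚ[1+n+m] : ∀ {m} → ℕ→ℚ (suc (n ℕ.+ m)) ≡ 1ℚ + (N + ℕ→ℚ m)
  ℕ→ℚ[1+n+m] {m} = trans (ℕ→ℚ-homo-+ 1 (n ℕ.+ m)) (cong (λ x → 1ℚ + x) (ℕ→ℚ-homo-+ n m))
  ℕ→ℚ[p²] : ℕ→ℚ (suc (n ℕ.+ n) ℕ.^ 2) ≡ (1ℚ + (N + N)) * ((1ℚ + (N + N)) * 1ℚ)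
  ℕ→ℚ[p²] = trans (ℕ→ℚ-homo-* (suc (n ℕ.+ n)) (suc (n ℕ.+ n) ℕ.* 1))
                  (cong₂ _*_ ℕ→ℚ[1+n+m] (trans (ℕ→ℚ-homo-* (suc (n ℕ.+ n)) 1) (cong (_* 1ℚ) ℕ→ℚ[1+n+m])))

ratios-congruent : ∀ {n j} → let p = suc (n ℕ.+ n) in Prime p → j < n →
  PIntegral p (binomSquareRatio minusHalf j) × PIntegral p (apéryRatio n j) ×
  binomSquareRatio minusHalf j ≡ apéryRatio n j [mod ℕ→ℚ (p ℕ.^ 2) at p ]
ratios-congruent {n} {j} p-prime j<n =
  pIntegral-neg p-prime (pIntegral-* p-prime r∈ℤₚ r∈ℤₚ) ,
  pIntegral-* p-prime (pIntegral-* p-prime (ℕ→ℚ-pIntegral p-prime (n ∸ j)) (ℕ→ℚ-pIntegral p-prime (suc (n ℕ.+ j)))) i²∈ℤₚ ,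
  congruentBy _ (pIntegral-neg p-prime (pIntegral-* p-prime hi∈ℤₚ hi∈ℤₚ)) (binomSquareRatio-apéryRatio (ℕₚ.<⇒≤ j<n))
  where
  p : ℕ
  p = suc (n ℕ.+ n)
  1≤n : 1 ≤ n
  1≤n = ℕₚ.≤-trans (ℕ.s≤s ℕ.z≤n) j<n
  i∈ℤₚ : PIntegral p (1/suc j)
  i∈ℤₚ = 1/suc-pIntegral p-prime (>⇒∤ (ℕ.s≤s (ℕₚ.≤-trans j<n (ℕₚ.m≤m+n n n))))
  h∈ℤₚ : PIntegral p minusHalf
  h∈ℤₚ = minusHalf-pIntegral p-prime (>⇒∤ (ℕ.s≤s (ℕₚ.+-mono-≤ 1≤n 1≤n)))
  r∈ℤₚ : PIntegral p ((minusHalf - ℕ→ℚ j) * 1/suc j)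
  r∈ℤₚ = pIntegral-* p-prime (pIntegral-- p-prime h∈ℤₚ (ℕ→ℚ-pIntegral p-prime j)) i∈ℤₚ
  i²∈ℤₚ : PIntegral p (1/suc j * 1/suc j)
  i²∈ℤₚ = pIntegral-* p-prime i∈ℤₚ i∈ℤₚ
  hi∈ℤₚ : PIntegral p (minusHalf * 1/suc j)
  hi∈ℤₚ = pIntegral-* p-prime h∈ℤₚ i∈ℤₚ

J₂≡A₂-mod-p² : ∀ n → let p = suc (n ℕ.+ n) in Prime p → J₂ n ≡ ℕ→ℚ (A₂ n) [mod ℕ→ℚ (p ℕ.^ 2) at p ]
J₂≡A₂-mod-p² n p-prime =
  subst (λ a → J₂ n ≡ a [mod p² at p ]) (sym (ℕ→ℚ-homo-sum _ n)) (≡-mod-sum p-prime _ _ n termwise)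
  where
  p : ℕ
  p = suc (n ℕ.+ n)
  p² : ℚ
  p² = ℕ→ℚ (p ℕ.^ 2)
  termwise : ∀ k → k ≤ n →
             signℚ k * (gbinom minusHalf k * gbinom minusHalf k) * ℕ→ℚ (n C k) ≡
             ℕ→ℚ ((n C k) ℕ.* (n C k) ℕ.* ((n ℕ.+ k) C k)) [mod p² at p ]
  termwise k k≤n = subst₂ (λ a b → a ≡ b [mod p² at p ])
    (cong (_* ℕ→ℚ (n C k)) (sym (signℚ*gbinom²≡prod minusHalf k)))
    (begin
      prodℚ (apéryRatio n) k * ℕ→ℚ (n C k)                    ≡⟨ cong (_* ℕ→ℚ (n C k)) (apéryTerm≡prod n k k≤n) ⟨
      ℕ→ℚ ((n C k) ℕ.* ((n ℕ.+ k) C k)) * ℕ→ℚ (n C k)         ≡⟨ ℕ→ℚ-homo-* ((n C k) ℕ.* ((n ℕ.+ k) C k)) (n C k) ⟨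
      ℕ→ℚ ((n C k) ℕ.* ((n ℕ.+ k) C k) ℕ.* (n C k))           ≡⟨ cong ℕ→ℚ (solve 2 (λ a b → a :* b :* a := a :* a :* b) refl (n C k) ((n ℕ.+ k) C k)) ⟩
      ℕ→ℚ ((n C k) ℕ.* (n C k) ℕ.* ((n ℕ.+ k) C k))           ∎)
    (≡-mod-* p-prime (pIntegral-prod p-prime (apéryRatio n) k (λ j j<k → proj₁ (proj₂ (ratios j j<k))))
                     (ℕ→ℚ-pIntegral p-prime (n C k))
                     (≡-mod-prod p-prime _ _ k ratios)
                     (≡-mod-refl p-prime (ℕ→ℚ (n C k))))
    where
    open ≡-Reasoning
    open ℕ-Solver
    ratios : ∀ j → j < k →
             PIntegral p (binomSquareRatio minusHalf j) × PIntegral p (apéryRatio n j) ×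
             binomSquareRatio minusHalf j ≡ apéryRatio n j [mod p² at p ]
    ratios j j<k = ratios-congruent p-prime (ℕₚ.<-≤-trans j<k k≤n)

odd-prime≡2n+1 : ∀ {p} → Prime p → p ≢ 2 → p ≡ suc ((p ∸ 1) / 2 ℕ.+ (p ∸ 1) / 2)
odd-prime≡2n+1 {p} p-prime p≢2 = trans p≡2q+1 (cong (λ n → suc (n ℕ.+ n)) (sym [p∸1]/2≡q))
  where
  open ℕ-Solver
  q : ℕ
  q = p / 2
  2∤p : ¬ 2 ∣ p
  2∤p 2∣p with prime⇒irreducible p-prime 2∣p
  ... | inj₁ ()
  ... | inj₂ 2≡p = p≢2 (sym 2≡p)
  p%2≡1 : p % 2 ≡ 1
  p%2≡1 with p % 2 in p%2≡r | m%n<n p 2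
  ... | 0           | _ = ⊥-elim (2∤p (m%n≡0⇒n∣m p 2 p%2≡r))
  ... | 1           | _ = refl
  ... | suc (suc _) | ℕ.s≤s (ℕ.s≤s ())
  p≡2q+1 : p ≡ suc (q ℕ.+ q)
  p≡2q+1 = trans (m≡m%n+[m/n]*n p 2) (cong₂ ℕ._+_ p%2≡1 (solve 1 (λ q → q :* con 2 := q :+ q) refl q))
  [p∸1]/2≡q : (p ∸ 1) / 2 ≡ q
  [p∸1]/2≡q = trans (cong (λ m → (m ∸ 1) / 2) p≡2q+1)
                    (trans (cong (_/ 2) (solve 1 (λ q → q :+ q := q :* con 2) refl q)) (m*n/n≡m q 2))

mainTheorem10 : (p : ℕ) → Prime p → p ≢ 2 →
    CongZp p 2 (J₂ ((p ∸ 1) / 2)) (ℕ→ℚ (A₂ ((p ∸ 1) / 2)))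
mainTheorem10 p p-prime p≢2 =
  subst (λ q → CongZp q 2 (J₂ n) (ℕ→ℚ (A₂ n))) (sym p≡2n+1)
        (≡-mod-p^e⇒CongZp {e = 2} (J₂≡A₂-mod-p² n (subst Prime p≡2n+1 p-prime)))
  where
  n : ℕ
  n = (p ∸ 1) / 2
  p≡2n+1 : p ≡ suc (n ℕ.+ n)
  p≡2n+1 = odd-prime≡2n+1 p-prime p≢2
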